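{- For any DIBI algebra $\mathbb{A}$, the prime filter frame $Pr(\mathbb{A})$ is a DIBI frame.
   Context: A DIBI algebra is $\mathbb{A}=(A,\wedge,\vee,\to,\top,\bot,*,\mathrel{ -\!\!*},\triangleright,\multimap_r,\multimap_l,I)$ such that for all $a,b,c,d\in A$: $(A,\wedge,\vee,\to,\top,\bot)$ is a Heyting algebra; $(A,*,I)$ is a commutative monoid; $\triangleright$ is associative with right unit $I$ and $a\le I\triangleright a$; $a*b\le c$ iff $a\le b\mathrel{ -\!\!*}c$; $a\triangleright b\le c$ iff $a\le b\multimap_r c$ iff $b\le a\multimap_l c$; $(a\triangleright b)*(c\triangleright d)\le(a*c)\triangleright(b*d)$. A prime filter of $\mathbb{A}$ is a nonempty upward-closed $F\subseteq A$, closed under $\wedge$, with $\bot\notin F$, and such that $x\vee y\in F$ implies $x\in F$ or $y\in F$. With $\mathbb{PF}_{\mathbb{A}}$ the set of prime filters, $Pr(\mathbb{A})=(\mathbb{PF}_{\mathbb{A}},\subseteq,\oplus_{\mathbb{A}},\odot_{\mathbb{A}},E_{\mathbb{A}})$ where $F\oplus_{\mathbb{A}}G=\{H\in\mathbb{PF}_{\mathbb{A}}\mid\forall a\in F,b\in G:\ a*b\in H\}$, $F\odot_{\mathbb{A}}G=\{H\in\mathbb{PF}_{\mathbb{A}}\mid\forall a\in F,b\in G:\ a\triangleright b\in H\}$, $E_{\mathbb{A}}=\{F\in\mathbb{PF}_{\mathbb{A}}\mid I\in F\}$. A DIBI frame is $(X,\sqsubseteq,\oplus,\odot,E)$ with $\sqsubseteq$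 a preorder on $X$, $E\subseteq X$, $\oplus,\odot:X\times X\to\mathcal P(X)$, satisfying (free variables universally quantified): ($\oplus$ Down-Closed) $z\in x\oplus y$, $x\sqsupseteq x'$, $y\sqsupseteq y'$ imply $\exists z'(z\sqsupseteq z'\wedge z'\in x'\oplus y')$; ($\odot$ Up-Closed) $z\in x\odot y$, $z'\sqsupseteq z$ imply $\exists x',y'(x'\sqsupseteq x\wedge y'\sqsupseteq y\wedge z'\in x'\odot y')$; ($\oplus$ Comm.) $z\in x\oplus y\Rightarrow z\in y\oplus x$; ($\oplus$ Assoc.) $w\in t\oplus z\wedge t\in x\oplus y\Rightarrow\exists s(s\in y\oplus z\wedge w\in x\oplus s)$; ($\oplus$ Unit Existence) $\exists e\in E(x\in e\oplus x)$; ($\oplus$ Unit Coherence) $e\in E\wedge x\in y\oplus e\Rightarrow x\sqsupseteq y$; ($\odot$ Assoc.) $\exists t(w\in t\odot z\wedge t\in x\odot y)\Leftrightarrow\exists s(s\in y\odot z\wedge w\in x\odot s)$; ($\odot$ Unit Existence$_{L}$) $\exists e\in E(x\in e\odot x)$; ($\odot$ Unit Existence$_R$) $\exists e\in E(x\in x\odot e)$; ($\odot$ Coherence$_R$) $e\in E\wedge x\in y\odot e\Rightarrow x\sqsupseteq y$; (Unit Closure) $e\in E\wedge e'\sqsupseteq e\Rightarrow e'\in E$; (Reverse Exchange) $x\in y\oplus z\wedge y\in y_1\odot y_2\wedge z\in z_1\odot z_2\Rightarrow\exists u,v(u\in y_1\oplus z_1\wedge v\in y_2\oplus z_2\wedge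 x\in u\odot v)$. -}

module Defs where

open import Level using (Level; _⊔_; suc)
open import Relation.Binary.Lattice.Bundles using (HeytingAlgebra)
open import Relation.Binary.Structures using (IsPreorder)
open import Relation.Binary.PropositionalEquality using (_≡_)
open import Algebra.Structures using (IsCommutativeMonoid)
open import Relation.Unary using (Pred; _∈_; _⊆_)
open import Data.Product using (Σ; ∃; ∃₂; _×_; proj₁)
open import Data.Sum using (_⊎_)
open import Data.Empty renaming (⊥ to Empty)
open import Relation.Nullary using (¬_)

record DIBIAlgebra (c ℓ₁ ℓ₂ : Level) : Set (suc (c ⊔ ℓ₁ ⊔ ℓ₂)) where
  field
    heyting : HeytingAlgebra c ℓ₁ ℓ₂
  open HeytingAlgebra heyting public
  infixr 7 _*_ _▷_
  infixr 5 _-*_ _⊸r_ _⊸l_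
  field
    _*_   : Carrier → Carrier → Carrier
    _-*_  : Carrier → Carrier → Carrier
    _▷_   : Carrier → Carrier → Carrier
    _⊸r_  : Carrier → Carrier → Carrier
    _⊸l_  : Carrier → Carrier → Carrier
    I     : Carrier
    *-isCommutativeMonoid : IsCommutativeMonoid _≈_ _*_ I
    ▷-assoc    : ∀ a b c → ((a ▷ b) ▷ c) ≈ (a ▷ (b ▷ c))
    ▷-identityʳ : ∀ a → (a ▷ I) ≈ a
    ▷-unitˡ-≤  : ∀ a → a ≤ (I ▷ a)
    *-residual₁ : ∀ {a b c} → (a * b) ≤ c → a ≤ (b -* c)
    *-residual₂ : ∀ {a b c} → a ≤ (b -* c) → (a * b) ≤ c
    ▷-residualʳ₁ : ∀ {a b c} → (a ▷ b) ≤ c → a ≤ (b ⊸r c)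
    ▷-residualʳ₂ : ∀ {a b c} → a ≤ (b ⊸r c) → (a ▷ b) ≤ c
    ▷-residualˡ₁ : ∀ {a b c} → (a ▷ b) ≤ c → b ≤ (a ⊸l c)
    ▷-residualˡ₂ : ∀ {a b c} → b ≤ (a ⊸l c) → (a ▷ b) ≤ c
    exchange : ∀ a b c d → ((a ▷ b) * (c ▷ d)) ≤ ((a * c) ▷ (b * d))

module _ {c ℓ₁ ℓ₂} (𝔸 : DIBIAlgebra c ℓ₁ ℓ₂) where
  open DIBIAlgebra 𝔸

  PLevel : Level
  PLevel = c ⊔ ℓ₁ ⊔ ℓ₂

  record IsPrimeFilter (F : Pred Carrier PLevel) : Set PLevel where
    field
      nonempty  : ∃ λ x → x ∈ F
      upClosed  : ∀ {x y} → x ≤ y → x ∈ F → y ∈ F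
      ∧-closed  : ∀ {x y} → x ∈ F → y ∈ F → (x ∧ y) ∈ F
      ⊥∉        : ¬ (⊥ ∈ F)
      prime     : ∀ {x y} → (x ∨ y) ∈ F → (x ∈ F) ⊎ (y ∈ F)

  PrimeFilter : Set (suc PLevel)
  PrimeFilter = Σ (Pred Carrier PLevel) IsPrimeFilter

  _⊑ᴾ_ : PrimeFilter → PrimeFilter → Set PLevel
  F ⊑ᴾ G = proj₁ F ⊆ proj₁ G

  _⊕ᴾ_ : PrimeFilter → PrimeFilter → Pred PrimeFilter PLevel
  (F ⊕ᴾ G) H = ∀ {a b} → a ∈ proj₁ F → b ∈ proj₁ G → (a * b) ∈ proj₁ H

  _⊙ᴾ_ : PrimeFilter → PrimeFilter → Pred PrimeFilter PLevel
  (F ⊙ᴾ G) H = ∀ {a b} → a ∈ proj₁ F → b ∈ proj₁ G → (a ▷ b) ∈ proj₁ H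

  Eᴾ : Pred PrimeFilter PLevel
  Eᴾ F = I ∈ proj₁ F

  -- (Metatheoretic axiom) the prime filter theorem for 𝔸: a filter
  -- disjoint from an ideal extends to a prime filter disjoint from it.
  record IsFilter (F : Pred Carrier PLevel) : Set PLevel where
    field
      ⊤∈       : ⊤ ∈ F
      upClosed : ∀ {x y} → x ≤ y → x ∈ F → y ∈ F
      ∧-closed : ∀ {x y} → x ∈ F → y ∈ F → (x ∧ y) ∈ F

  record IsIdeal (J : Pred Carrier PLevel) : Set PLevel where
    field
      ⊥∈         : ⊥ ∈ J
      downClosed : ∀ {x y} → x ≤ y → y ∈ J → x ∈ J
      ∨-closed   : ∀ {x y} → x ∈ J → y ∈ J → (x ∨ y) ∈ J

  PrimeFilterTheorem : Set (suc PLevel)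
  PrimeFilterTheorem =
    (F J : Pred Carrier PLevel) → IsFilter F → IsIdeal J →
    (∀ {x} → x ∈ F → x ∈ J → Empty) →
    ∃ λ (P : PrimeFilter) → (F ⊆ proj₁ P) × (∀ {x} → x ∈ proj₁ P → x ∈ J → Empty)

-- DIBI frames.  x ⊒ y is written y ⊑ x.

record IsDIBIFrame {x r p q : Level} (X : Set x) (_⊑_ : X → X → Set r)
                   (_⊕_ _⊙_ : X → X → Pred X p) (E : Pred X q)
                   : Set (x ⊔ r ⊔ p ⊔ q) where
  field
    isPreorder : IsPreorder _≡_ _⊑_
    ⊕-downClosed : ∀ {x y z x′ y′} → z ∈ (x ⊕ y) → x′ ⊑ x → y′ ⊑ y →
                   ∃ λ z′ → (z′ ⊑ z) × (z′ ∈ (x′ ⊕ y′))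
    ⊙-upClosed   : ∀ {x y z z′} → z ∈ (x ⊙ y) → z ⊑ z′ →
                   ∃₂ λ x′ y′ → (x ⊑ x′) × (y ⊑ y′) × (z′ ∈ (x′ ⊙ y′))
    ⊕-comm       : ∀ {x y z} → z ∈ (x ⊕ y) → z ∈ (y ⊕ x)
    ⊕-assoc      : ∀ {w t x y z} → w ∈ (t ⊕ z) → t ∈ (x ⊕ y) →
                   ∃ λ s → (s ∈ (y ⊕ z)) × (w ∈ (x ⊕ s))
    ⊕-unitExistence : ∀ x → ∃ λ e → (e ∈ E) × (x ∈ (e ⊕ x))
    ⊕-unitCoherence : ∀ {e x y} → e ∈ E → x ∈ (y ⊕ e) → y ⊑ x
    ⊙-assoc₁     : ∀ {w x y z} → (∃ λ t → (w ∈ (t ⊙ z)) × (t ∈ (x ⊙ y))) →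
                   ∃ λ s → (s ∈ (y ⊙ z)) × (w ∈ (x ⊙ s))
    ⊙-assoc₂     : ∀ {w x y z} → (∃ λ s → (s ∈ (y ⊙ z)) × (w ∈ (x ⊙ s))) →
                   ∃ λ t → (w ∈ (t ⊙ z)) × (t ∈ (x ⊙ y))
    ⊙-unitExistenceˡ : ∀ x → ∃ λ e → (e ∈ E) × (x ∈ (e ⊙ x))
    ⊙-unitExistenceʳ : ∀ x → ∃ λ e → (e ∈ E) × (x ∈ (x ⊙ e))
    ⊙-coherenceʳ : ∀ {e x y} → e ∈ E → x ∈ (y ⊙ e) → y ⊑ x
    unitClosure  : ∀ {e e′} → e ∈ E → e ⊑ e′ → e′ ∈ E
    reverseExchange : ∀ {x y z y₁ y₂ z₁ z₂} →
                   x ∈ (y ⊕ z) → y ∈ (y₁ ⊙ y₂) → z ∈ (z₁ ⊙ z₂) →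
                   ∃₂ λ u v → (u ∈ (y₁ ⊕ z₁)) × (v ∈ (y₂ ⊕ z₂)) × (x ∈ (u ⊙ v))

-- Every frame condition asserts the existence of prime filters, and all of
-- them come from one prime extension lemma. Let ∘ be an operator (monotone,
-- and preserving ∨ and ⊥ in each argument, as every residuated operation is),
-- F and G filters and H a prime filter with F ∘ G ⊆ H. Then G extends to a
-- prime filter P with F ∘ P ⊆ H: apply the prime filter theorem to G and the
-- ideal {d | a ∘ d ∉ H for some a ∈ F}. The filters to be extended are
-- upward closures of pointwise products F ∘ G of prime filters, or the
-- principal filter of I; reverse exchange extends on both sides in turn.
module Submission where

open import Defs
open import Level using (_⊔_; Lift; lift)
open import Function using (flip)
open import Algebra.Core using (Op₂)
open import Algebra.Structures using (IsCommutativeMonoid)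
open import Axiom.ExcludedMiddle using (ExcludedMiddle)
open import Axiom.DoubleNegationElimination using (em⇒dne)
open import Relation.Binary.Core using (_Preserves₂_⟶_⟶_)
open import Relation.Binary.Lattice.Bundles using (BoundedJoinSemilattice; BoundedLattice)
open import Relation.Binary.PropositionalEquality using (_≡_; refl; isEquivalence)
open import Relation.Unary using (Pred; _∈_; _⊆_)
open import Relation.Unary.Properties using (⊆-trans)
open import Relation.Nullary using (¬_)
open import Data.Product using (∃; ∃₂; _×_; _,_; proj₁; proj₂)
open import Data.Sum using ([_,_]′)
open import Data.Empty using () renaming (⊥ to Empty)

module Operator {c ℓ₁ ℓ₂} (L : BoundedJoinSemilattice c ℓ₁ ℓ₂) where
  open BoundedJoinSemilattice L renaming (refl to ≤-refl)

  record IsOperator (_∘_ : Op₂ Carrier) : Set (c ⊔ ℓ₂) where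
    field
      monotonic : _∘_ Preserves₂ _≤_ ⟶ _≤_ ⟶ _≤_
      additiveˡ : ∀ a a′ b → ((a ∨ a′) ∘ b) ≤ ((a ∘ b) ∨ (a′ ∘ b))
      additiveʳ : ∀ a b b′ → (a ∘ (b ∨ b′)) ≤ ((a ∘ b) ∨ (a ∘ b′))
      normalˡ   : ∀ b → (⊥ ∘ b) ≤ ⊥
      normalʳ   : ∀ a → (a ∘ ⊥) ≤ ⊥

  flip-isOperator : ∀ {_∘_} → IsOperator _∘_ → IsOperator (flip _∘_)
  flip-isOperator op = record
    { monotonic = λ p q → monotonic q p
    ; additiveˡ = λ a a′ b → additiveʳ b a a′
    ; additiveʳ = λ a b b′ → additiveˡ b b′ a
    ; normalˡ   = normalʳ
    ; normalʳ   = normalˡ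
    }
    where open IsOperator op

  residuated⇒isOperator :
    ∀ {_∘_ _⇒ʳ_ _⇒ˡ_ : Op₂ Carrier} →
    (∀ {a b d} → (a ∘ b) ≤ d → a ≤ (b ⇒ʳ d)) → (∀ {a b d} → a ≤ (b ⇒ʳ d) → (a ∘ b) ≤ d) →
    (∀ {a b d} → (a ∘ b) ≤ d → b ≤ (a ⇒ˡ d)) → (∀ {a b d} → b ≤ (a ⇒ˡ d) → (a ∘ b) ≤ d) →
    IsOperator _∘_
  residuated⇒isOperator {_∘_} toʳ fromʳ toˡ fromˡ = record
    { monotonic = λ p q → trans (monotonicˡ p) (monotonicʳ q)
    ; additiveˡ = λ _ _ _ → fromʳ (∨-least (toʳ (x≤x∨y _ _)) (toʳ (y≤x∨y _ _)))
    ; additiveʳ = λ _ _ _ → fromˡ (∨-least (toˡ (x≤x∨y _ _)) (toˡ (y≤x∨y _ _)))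
    ; normalˡ   = λ _ → fromʳ (minimum _)
    ; normalʳ   = λ _ → fromˡ (minimum _)
    }
    where
    monotonicˡ : ∀ {a a′ b} → a ≤ a′ → (a ∘ b) ≤ (a′ ∘ b)
    monotonicˡ p = fromʳ (trans p (toʳ ≤-refl))

    monotonicʳ : ∀ {a b b′} → b ≤ b′ → (a ∘ b) ≤ (a ∘ b′)
    monotonicʳ p = fromˡ (trans p (toˡ ≤-refl))

module PrimeFilterFrame {c ℓ₁ ℓ₂} (𝔸 : DIBIAlgebra c ℓ₁ ℓ₂) where
  open DIBIAlgebra 𝔸 renaming (refl to ≤-refl)
  open IsCommutativeMonoid *-isCommutativeMonoid using (assoc; comm; identityˡ; identityʳ)
  open Operator (BoundedLattice.boundedJoinSemilattice boundedLattice)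

  private
    Subset : Set _
    Subset = Pred Carrier (PLevel 𝔸)

  *-isOperator : IsOperator _*_
  *-isOperator = residuated⇒isOperator *-residual₁ *-residual₂
    (λ ab≤d → *-residual₁ (trans (reflexive (comm _ _)) ab≤d))
    (λ b≤a-*d → trans (reflexive (comm _ _)) (*-residual₂ b≤a-*d))

  ▷-isOperator : IsOperator _▷_
  ▷-isOperator = residuated⇒isOperator ▷-residualʳ₁ ▷-residualʳ₂ ▷-residualˡ₁ ▷-residualˡ₂

  *-assoc≤ : ∀ a b c → ((a * b) * c) ≤ (a * (b * c))
  *-assoc≤ a b c = reflexive (assoc a b c)

  *-identityˡ≥ : ∀ a → a ≤ (I * a)
  *-identityˡ≥ a = reflexive (Eq.sym (identityˡ a))

  *-identityʳ≤ : ∀ a → (a * I) ≤ a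
  *-identityʳ≤ a = reflexive (identityʳ a)

  ▷-assoc≤ : ∀ a b c → ((a ▷ b) ▷ c) ≤ (a ▷ (b ▷ c))
  ▷-assoc≤ a b c = reflexive (▷-assoc a b c)

  ▷-assoc≥ : ∀ a b c → (a ▷ (b ▷ c)) ≤ ((a ▷ b) ▷ c)
  ▷-assoc≥ a b c = reflexive (Eq.sym (▷-assoc a b c))

  ▷-identityʳ≥ : ∀ a → a ≤ (a ▷ I)
  ▷-identityʳ≥ a = reflexive (Eq.sym (▷-identityʳ a))

  ▷-identityʳ≤ : ∀ a → (a ▷ I) ≤ a
  ▷-identityʳ≤ a = reflexive (▷-identityʳ a)

  infix 4 _⟨_⟩_⊆_ _⟨_⟩ᴾ_⊆_
  infix 8 ↑_

  _⟨_⟩_⊆_ : Subset → Op₂ Carrier → Subset → Subset → Set (PLevel 𝔸)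
  F ⟨ _∘_ ⟩ G ⊆ H = ∀ {a b} → a ∈ F → b ∈ G → (a ∘ b) ∈ H

  ↑_ : Subset → Subset
  (↑ S) d = ∃ λ s → s ∈ S × s ≤ d

  ｛_｝ : Carrier → Subset
  ｛ a ｝ d = Lift (PLevel 𝔸) (a ≡ d)

  image₂ : Op₂ Carrier → Subset → Subset → Subset
  image₂ _∘_ F G d = ∃₂ λ a b → a ∈ F × b ∈ G × (a ∘ b) ≡ d

  DownDirected : Subset → Set (PLevel 𝔸)
  DownDirected S = ∀ {s s′} → s ∈ S → s′ ∈ S → ∃ λ t → t ∈ S × t ≤ s × t ≤ s′

  ⊆-↑ : ∀ {S} → S ⊆ ↑ S
  ⊆-↑ {x = s} s∈S = s , s∈S , ≤-refl

  ↑-isFilter : ∀ {S} → ∃ (_∈ S) → DownDirected S → IsFilter 𝔸 (↑ S)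
  ↑-isFilter (s , s∈S) directed = record
    { ⊤∈       = s , s∈S , maximum s
    ; upClosed = λ { d≤d′ (t , t∈S , t≤d) → t , t∈S , trans t≤d d≤d′ }
    ; ∧-closed = λ { (t , t∈S , t≤d) (t′ , t′∈S , t′≤d′) →
        let u , u∈S , u≤t , u≤t′ = directed t∈S t′∈S
        in u , u∈S , ∧-greatest (trans u≤t t≤d) (trans u≤t′ t′≤d′) }
    }

  ↑｛｝-isFilter : ∀ a → IsFilter 𝔸 (↑ ｛ a ｝)
  ↑｛｝-isFilter a = ↑-isFilter (a , lift refl)
    λ { (lift refl) (lift refl) → a , lift refl , ≤-refl , ≤-refl }

  ↑image₂-isFilter : ∀ {_∘_ F G} → IsOperator _∘_ → IsFilter 𝔸 F → IsFilter 𝔸 G →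
                     IsFilter 𝔸 (↑ image₂ _∘_ F G)
  ↑image₂-isFilter {_∘_} op F-filter G-filter =
    ↑-isFilter (⊤ ∘ ⊤ , ⊤ , ⊤ , F.⊤∈ , G.⊤∈ , refl) directed
    where
    module F = IsFilter F-filter
    module G = IsFilter G-filter
    open IsOperator op

    directed : DownDirected (image₂ _∘_ _ _)
    directed (a , b , a∈F , b∈G , refl) (a′ , b′ , a′∈F , b′∈G , refl) =
      (a ∧ a′) ∘ (b ∧ b′) , (a ∧ a′ , b ∧ b′ , F.∧-closed a∈F a′∈F , G.∧-closed b∈G b′∈G , refl) ,
      monotonic (x∧y≤x a a′) (x∧y≤x b b′) , monotonic (x∧y≤y a a′) (x∧y≤y b b′)

  isPrimeFilter⇒isFilter : ∀ {F} → IsPrimeFilter 𝔸 F → IsFilter 𝔸 F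
  isPrimeFilter⇒isFilter F-prime = record
    { ⊤∈       = upClosed (maximum _) (proj₂ nonempty)
    ; upClosed = upClosed
    ; ∧-closed = ∧-closed
    }
    where open IsPrimeFilter F-prime

  _⟨_⟩ᴾ_⊆_ : PrimeFilter 𝔸 → Op₂ Carrier → PrimeFilter 𝔸 → PrimeFilter 𝔸 → Set (PLevel 𝔸)
  F ⟨ _∘_ ⟩ᴾ G ⊆ H = proj₁ F ⟨ _∘_ ⟩ proj₁ G ⊆ proj₁ H

  upClosedᴾ : (P : PrimeFilter 𝔸) → ∀ {a b} → a ≤ b → a ∈ proj₁ P → b ∈ proj₁ P
  upClosedᴾ P = IsPrimeFilter.upClosed (proj₂ P)

  filterᴾ : (P : PrimeFilter 𝔸) → IsFilter 𝔸 (proj₁ P)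
  filterᴾ P = isPrimeFilter⇒isFilter (proj₂ P)

  ⊕ᴾ-comm : ∀ {x y z} → x ⟨ _*_ ⟩ᴾ y ⊆ z → y ⟨ _*_ ⟩ᴾ x ⊆ z
  ⊕ᴾ-comm {z = z} xy⊆z b∈y a∈x = upClosedᴾ z (reflexive (comm _ _)) (xy⊆z a∈x b∈y)

  coherenceʳ : ∀ {_∘_ u} → (∀ a → (a ∘ u) ≤ a) →
               ∀ {e x y} → u ∈ proj₁ e → y ⟨ _∘_ ⟩ᴾ e ⊆ x → _⊑ᴾ_ 𝔸 y x
  coherenceʳ a∘u≤a {x = x} u∈e ye⊆x a∈y = upClosedᴾ x (a∘u≤a _) (ye⊆x a∈y u∈e)

  module _ {_∘_ : Op₂ Carrier} (op : IsOperator _∘_) (H : PrimeFilter 𝔸) where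
    open IsOperator op using (monotonic)
    open IsPrimeFilter (proj₂ H) using (upClosed)

    ⟨⟩-↑ˡ : ∀ {S G} → S ⟨ _∘_ ⟩ G ⊆ proj₁ H → ↑ S ⟨ _∘_ ⟩ G ⊆ proj₁ H
    ⟨⟩-↑ˡ SG⊆H (s , s∈S , s≤a) b∈G = upClosed (monotonic s≤a ≤-refl) (SG⊆H s∈S b∈G)

    ⟨⟩-↑ʳ : ∀ {F S} → F ⟨ _∘_ ⟩ S ⊆ proj₁ H → F ⟨ _∘_ ⟩ ↑ S ⊆ proj₁ H
    ⟨⟩-↑ʳ FS⊆H a∈F (s , s∈S , s≤b) = upClosed (monotonic ≤-refl s≤b) (FS⊆H a∈F s∈S)

  ↑image₂⊆⇒⟨⟩⊆ : ∀ {_∘_ F G P} → ↑ image₂ _∘_ F G ⊆ P → F ⟨ _∘_ ⟩ G ⊆ P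
  ↑image₂⊆⇒⟨⟩⊆ FG⊆P a∈F b∈G = FG⊆P (⊆-↑ (_ , _ , a∈F , b∈G , refl))

  module Classical (em : ExcludedMiddle (PLevel 𝔸)) (pft : PrimeFilterTheorem 𝔸) where

    primeExtensionʳ : ∀ {_∘_ F G} → IsOperator _∘_ →
                      IsFilter 𝔸 F → IsFilter 𝔸 G → (H : PrimeFilter 𝔸) →
                      F ⟨ _∘_ ⟩ G ⊆ proj₁ H →
                      ∃ λ (P : PrimeFilter 𝔸) → G ⊆ proj₁ P × F ⟨ _∘_ ⟩ proj₁ P ⊆ proj₁ H
    primeExtensionʳ {_∘_} {F} {G} op F-filter G-filter (H , H-prime) FG⊆H =
      let P , G⊆P , P∩J=∅ = pft G J G-filter J-ideal G∩J=∅
      in P , G⊆P , λ a∈F d∈P → em⇒dne em λ a∘d∉H → P∩J=∅ d∈P (_ , a∈F , a∘d∉H)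
      where
      module F = IsFilter F-filter
      open IsPrimeFilter H-prime
      open IsOperator op

      J : Subset
      J d = ∃ λ a → a ∈ F × ¬ (a ∘ d) ∈ H

      J-ideal : IsIdeal 𝔸 J
      J-ideal = record
        { ⊥∈         = ⊤ , F.⊤∈ , λ ⊤∘⊥∈H → ⊥∉ (upClosed (normalʳ ⊤) ⊤∘⊥∈H)
        ; downClosed = λ { d≤d′ (a , a∈F , a∘d′∉H) →
            a , a∈F , λ a∘d∈H → a∘d′∉H (upClosed (monotonic ≤-refl d≤d′) a∘d∈H) }
        ; ∨-closed   = λ { {d} {d′} (a , a∈F , a∘d∉H) (a′ , a′∈F , a′∘d′∉H) →
            a ∧ a′ , F.∧-closed a∈F a′∈F , λ a∧a′∘d∨d′∈H →
              [ (λ m → a∘d∉H (upClosed (monotonic (x∧y≤x a a′) ≤-refl) m))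
              , (λ m → a′∘d′∉H (upClosed (monotonic (x∧y≤y a a′) ≤-refl) m)) ]′
              (prime (upClosed (additiveʳ (a ∧ a′) d d′) a∧a′∘d∨d′∈H)) }
        }

      G∩J=∅ : ∀ {d} → d ∈ G → d ∈ J → Empty
      G∩J=∅ d∈G (a , a∈F , a∘d∉H) = a∘d∉H (FG⊆H a∈F d∈G)

    primeExtensionˡ : ∀ {_∘_ F G} → IsOperator _∘_ →
                      IsFilter 𝔸 F → IsFilter 𝔸 G → (H : PrimeFilter 𝔸) →
                      F ⟨ _∘_ ⟩ G ⊆ proj₁ H →
                      ∃ λ (P : PrimeFilter 𝔸) → F ⊆ proj₁ P × proj₁ P ⟨ _∘_ ⟩ G ⊆ proj₁ H
    primeExtensionˡ op F-filter G-filter H FG⊆H =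
      let P , F⊆P , GP⊆H = primeExtensionʳ (flip-isOperator op) G-filter F-filter H
                             λ b∈G a∈F → FG⊆H a∈F b∈G
      in P , F⊆P , λ a∈P b∈G → GP⊆H b∈G a∈P

    unitExistenceˡ : ∀ {_∘_ u} → IsOperator _∘_ → (∀ a → a ≤ (u ∘ a)) →
                     ∀ x → ∃ λ e → u ∈ proj₁ e × e ⟨ _∘_ ⟩ᴾ x ⊆ x
    unitExistenceˡ {u = u} op a≤u∘a x =
      let e , ↑u⊆e , ex⊆x = primeExtensionˡ op (↑｛｝-isFilter u) (filterᴾ x) x
                             (⟨⟩-↑ˡ op x λ { (lift refl) b∈x → upClosedᴾ x (a≤u∘a _) b∈x })
      in e , ↑u⊆e (⊆-↑ (lift refl)) , ex⊆x

    unitExistenceʳ : ∀ {_∘_ u} → IsOperator _∘_ → (∀ a → a ≤ (a ∘ u)) →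
                     ∀ x → ∃ λ e → u ∈ proj₁ e × x ⟨ _∘_ ⟩ᴾ e ⊆ x
    unitExistenceʳ {u = u} op a≤a∘u x =
      let e , ↑u⊆e , xe⊆x = primeExtensionʳ op (filterᴾ x) (↑｛｝-isFilter u) x
                             (⟨⟩-↑ʳ op x λ { a∈x (lift refl) → upClosedᴾ x (a≤a∘u _) a∈x })
      in e , ↑u⊆e (⊆-↑ (lift refl)) , xe⊆x

    assocʳ : ∀ {_∘_} → IsOperator _∘_ → (∀ a b c → ((a ∘ b) ∘ c) ≤ (a ∘ (b ∘ c))) →
             ∀ {w t x y z} → t ⟨ _∘_ ⟩ᴾ z ⊆ w → x ⟨ _∘_ ⟩ᴾ y ⊆ t →
             ∃ λ s → y ⟨ _∘_ ⟩ᴾ z ⊆ s × x ⟨ _∘_ ⟩ᴾ s ⊆ w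
    assocʳ op assoc≤ {w} {x = x} {y} {z} tz⊆w xy⊆t =
      let s , yz⊆s , xs⊆w = primeExtensionʳ op (filterᴾ x)
                              (↑image₂-isFilter op (filterᴾ y) (filterᴾ z)) w
                              (⟨⟩-↑ʳ op w λ { a∈x (b , c , b∈y , c∈z , refl) →
                                upClosedᴾ w (assoc≤ _ b c) (tz⊆w (xy⊆t a∈x b∈y) c∈z) })
      in s , ↑image₂⊆⇒⟨⟩⊆ yz⊆s , xs⊆w

    assocˡ : ∀ {_∘_} → IsOperator _∘_ → (∀ a b c → (a ∘ (b ∘ c)) ≤ ((a ∘ b) ∘ c)) →
             ∀ {w s x y z} → y ⟨ _∘_ ⟩ᴾ z ⊆ s → x ⟨ _∘_ ⟩ᴾ s ⊆ w →
             ∃ λ t → t ⟨ _∘_ ⟩ᴾ z ⊆ w × x ⟨ _∘_ ⟩ᴾ y ⊆ t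
    assocˡ op assoc≤ {w} {x = x} {y} {z} yz⊆s xs⊆w =
      let t , xy⊆t , tz⊆w = primeExtensionˡ op
                              (↑image₂-isFilter op (filterᴾ x) (filterᴾ y)) (filterᴾ z) w
                              (⟨⟩-↑ˡ op w λ { (a , b , a∈x , b∈y , refl) c∈z →
                                upClosedᴾ w (assoc≤ a b _) (xs⊆w a∈x (yz⊆s b∈y c∈z)) })
      in t , tz⊆w , ↑image₂⊆⇒⟨⟩⊆ xy⊆t

    reverseExchange : ∀ {x y z y₁ y₂ z₁ z₂} →
                      y ⟨ _*_ ⟩ᴾ z ⊆ x → y₁ ⟨ _▷_ ⟩ᴾ y₂ ⊆ y → z₁ ⟨ _▷_ ⟩ᴾ z₂ ⊆ z →
                      ∃₂ λ u v → y₁ ⟨ _*_ ⟩ᴾ z₁ ⊆ u × y₂ ⟨ _*_ ⟩ᴾ z₂ ⊆ v × u ⟨ _▷_ ⟩ᴾ v ⊆ x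
    reverseExchange {x} {y₁ = y₁} {y₂} {z₁} {z₂} yz⊆x y₁y₂⊆y z₁z₂⊆z =
      let u , ↑U⊆u , u↑V⊆x = primeExtensionˡ ▷-isOperator ↑U-filter ↑V-filter x ↑U↑V⊆x
          v , ↑V⊆v , uv⊆x  = primeExtensionʳ ▷-isOperator (filterᴾ u) ↑V-filter x u↑V⊆x
      in u , v , ↑image₂⊆⇒⟨⟩⊆ ↑U⊆u , ↑image₂⊆⇒⟨⟩⊆ ↑V⊆v , uv⊆x
      where
      U V : Subset
      U = image₂ _*_ (proj₁ y₁) (proj₁ z₁)
      V = image₂ _*_ (proj₁ y₂) (proj₁ z₂)

      ↑U-filter : IsFilter 𝔸 (↑ U)
      ↑U-filter = ↑image₂-isFilter *-isOperator (filterᴾ y₁) (filterᴾ z₁)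

      ↑V-filter : IsFilter 𝔸 (↑ V)
      ↑V-filter = ↑image₂-isFilter *-isOperator (filterᴾ y₂) (filterᴾ z₂)

      UV⊆x : U ⟨ _▷_ ⟩ V ⊆ proj₁ x
      UV⊆x (a , c , a∈y₁ , c∈z₁ , refl) (b , e , b∈y₂ , e∈z₂ , refl) =
        upClosedᴾ x (exchange a b c e) (yz⊆x (y₁y₂⊆y a∈y₁ b∈y₂) (z₁z₂⊆z c∈z₁ e∈z₂))

      ↑U↑V⊆x : ↑ U ⟨ _▷_ ⟩ ↑ V ⊆ proj₁ x
      ↑U↑V⊆x = ⟨⟩-↑ˡ ▷-isOperator x (⟨⟩-↑ʳ ▷-isOperator x UV⊆x)

mainTheorem3 : ∀ {c ℓ₁ ℓ₂} (𝔸 : DIBIAlgebra c ℓ₁ ℓ₂) →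
    ExcludedMiddle (c ⊔ ℓ₁ ⊔ ℓ₂) → PrimeFilterTheorem 𝔸 →
    IsDIBIFrame (PrimeFilter 𝔸) (_⊑ᴾ_ 𝔸) (_⊕ᴾ_ 𝔸) (_⊙ᴾ_ 𝔸) (Eᴾ 𝔸)
-- Prime filters occur in these goals only under proj₁, so they cannot be
-- inferred and are passed on explicitly.
mainTheorem3 𝔸 em pft = record
  { isPreorder       = record { isEquivalence = isEquivalence
                              ; reflexive = λ { refl a → a }
                              ; trans = ⊆-trans }
  ; ⊕-downClosed     = λ {z = z} xy⊆z x′⊆x y′⊆y → z , (λ a → a) , λ a b → xy⊆z (x′⊆x a) (y′⊆y b)
  ; ⊙-upClosed       = λ {x} {y} xy⊆z z⊆z′ → x , y , (λ a → a) , (λ b → b) , λ a b → z⊆z′ (xy⊆z a b)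
  ; ⊕-comm           = λ {x y z} → ⊕ᴾ-comm {x} {y} {z}
  ; ⊕-assoc          = λ {w t x y z} → assocʳ *-isOperator *-assoc≤ {w} {t} {x} {y} {z}
  ; ⊕-unitExistence  = unitExistenceˡ *-isOperator *-identityˡ≥
  ; ⊕-unitCoherence  = λ {e x y} → coherenceʳ *-identityʳ≤ {e} {x} {y}
  ; ⊙-assoc₁         = λ {w x y z} (t , tz⊆w , xy⊆t) →
                         assocʳ ▷-isOperator ▷-assoc≤ {w} {t} {x} {y} {z} tz⊆w xy⊆t
  ; ⊙-assoc₂         = λ {w x y z} (s , yz⊆s , xs⊆w) →
                         assocˡ ▷-isOperator ▷-assoc≥ {w} {s} {x} {y} {z} yz⊆s xs⊆w
  ; ⊙-unitExistenceˡ = unitExistenceˡ ▷-isOperator ▷-unitˡ-≤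
  ; ⊙-unitExistenceʳ = unitExistenceʳ ▷-isOperator ▷-identityʳ≥
  ; ⊙-coherenceʳ     = λ {e x y} → coherenceʳ ▷-identityʳ≤ {e} {x} {y}
  ; unitClosure      = λ u∈e e⊆e′ → e⊆e′ u∈e
  ; reverseExchange  = λ {x y z y₁ y₂ z₁ z₂} → reverseExchange {x} {y} {z} {y₁} {y₂} {z₁} {z₂}
  }
  where
  open PrimeFilterFrame 𝔸
  open Classical em pft
  open DIBIAlgebra 𝔸 using (▷-unitˡ-≤)
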